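{- Let $a,b$ be positive integers with $\gcd(a,b)=1$. For every partition $\pi\in\mathcal{D}_{b,-a}(a,b)$, $$\mathrm{word}(\mathrm{G}_{b,a}(\pi))=\mathrm{sw}^{+}_{b,-a}\circ\mathrm{rev}(\mathrm{word}(\pi)).$$
   Context: A partition $\lambda$ with at most $a$ parts and largest part at most $b$ is identified with the set of unit squares of $[0,b]\times[0,a]$ lying northwest of a lattice path from $(0,0)$ to $(b,a)$ with unit north ($\mathrm{N}$) and east ($\mathrm{E}$) steps (its path); $\mathrm{word}(\lambda)$ is the word of that path (with $a$ letters $\mathrm{N}$ and $b$ letters $\mathrm{E}$). $\mathrm{rev}$ reverses a word. The level of a lattice point $(x,y)$ is $by-ax$; a unit lattice square has the level of its southeast corner. $\mathcal{D}_{b,-a}(a,b)$ is the set of such partitions whose path visits only points of level $\ge0$. For $\pi\in\mathcal{D}_{b,-a}(a,b)$: its $b$-generators $\beta_1<\beta_2<\cdots<\beta_b$ are the levels of the $b$ unit squares lying immediately north of the $b$ east steps of the path of $\pi$. Let $\Delta^c$ be the (finite) set of levels of the unit squares lying between the path of $\pi$ and the line $by=ax$ (southeast of the path, above the line). For each $i$ set $g_{b,a}(\beta_i)=|\{\beta_i,\beta_i+1,\dots,\beta_i+a-1\}\cap\Delta^c|$. $\mathrm{G}_{b,a}(\pi)$ is the partition whose $i$-th column (from the left) has length $g_{b,a}(\beta_i)$, $1\le i\le b$. $\mathrm{sw}^+_{b,-a}$: for a word $u=u_1\cdots u_N$ set $l_0=0$, $l_i=l_{i-1}+b$ if $u_i=\mathrm{N}$,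 $l_i=l_{i-1}-a$ if $u_i=\mathrm{E}$; the output is obtained by taking $k=0$, then $k=-1,-2,\dots$, then all positive $k$ in decreasing order, and for each $k$ scanning $u$ from left to right, appending each $u_i$ ($i\ge1$) with $l_i=k$. -}

module Defs where

open import Data.Nat as ℕ using (ℕ; zero; suc; _∸_)
open import Data.Integer as ℤ using (ℤ; +_; -_)
open import Data.Integer.Properties using (≤-decTotalOrder)
open import Data.List using (List; []; _∷_; _++_; [_]; replicate; reverse; length; map; filter; upTo; concatMap)
open import Data.List.Relation.Unary.All using (All)
open import Data.List.Relation.Unary.Linked using (Linked)
open import Data.List.Membership.DecPropositional ℤ._≟_ using (_∈?_)
open import Data.List.Sort.InsertionSort ≤-decTotalOrder using (sort)
open import Data.Product using (_×_; _,_; proj₁; proj₂)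

data Step : Set where
  N E : Step

level : ℕ → ℕ → ℕ → ℕ → ℤ
level a b x y = + (b ℕ.* y) ℤ.- + (a ℕ.* x)

IsPartitionIn : ℕ → ℕ → List ℕ → Set
IsPartitionIn a b λs =
  Linked ℕ._≥_ λs × All (λ p → 1 ℕ.≤ p × p ℕ.≤ b) λs × length λs ℕ.≤ a

-- word of the path from (0,0) to (b,a) bounding the partition
-- (cells of the partition lie north-west of the path; top row = λ₁).
wordRows : ℕ → ℕ → List ℕ → List Step
wordRows b prev [] = replicate (b ∸ prev) E
wordRows b prev (r ∷ rs) = replicate (r ∸ prev) E ++ N ∷ wordRows b r rs

word : ℕ → ℕ → List ℕ → List Step
word a b λs = wordRows b 0 (reverse (λs ++ replicate (a ∸ length λs) 0))

-- word of the partition in the a×b box whose i-th column (from the left)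
-- has length cᵢ : the path goes N up to height a - c₁, E, N up to a - c₂, E, …
wordCols : ℕ → ℕ → List ℕ → List Step
wordCols a h [] = replicate (a ∸ h) N
wordCols a h (c ∷ cs) = replicate ((a ∸ c) ∸ h) N ++ E ∷ wordCols a (a ∸ c) cs

wordOfColumns : ℕ → List ℕ → List Step
wordOfColumns a cs = wordCols a 0 cs

pathPoints : ℕ → ℕ → List Step → List (ℕ × ℕ)
pathPoints x y [] = [ (x , y) ]
pathPoints x y (N ∷ w) = (x , y) ∷ pathPoints x (suc y) w
pathPoints x y (E ∷ w) = (x , y) ∷ pathPoints (suc x) y w

InD : ℕ → ℕ → List ℕ → Set
InD a b π = IsPartitionIn a b π
          × All (λ p → + 0 ℤ.≤ level a b (proj₁ p) (proj₂ p)) (pathPoints 0 0 (word a b π))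

-- levels of the unit squares immediately north of the E steps
-- (the square north of the E step (x,y)→(x+1,y) has SE corner (x+1,y))
genLevels : ℕ → ℕ → ℕ → ℕ → List Step → List ℤ
genLevels a b x y [] = []
genLevels a b x y (N ∷ w) = genLevels a b x (suc y) w
genLevels a b x y (E ∷ w) = level a b (suc x) y ∷ genLevels a b (suc x) y w

generators : ℕ → ℕ → List ℕ → List ℤ
generators a b π = sort (genLevels a b 0 0 (word a b π))

-- levels of the squares south-east of the path (below an E step) lying above
-- the line b y = a x (SE corner of positive level)
deltaCw : ℕ → ℕ → ℕ → ℕ → List Step → List ℤ
deltaCw a b x y [] = []
deltaCw a b x y (N ∷ w) = deltaCw a b x (suc y) w
deltaCw a b x y (E ∷ w) =
  filter (+ 0 ℤ.<?_) (map (level a b (suc x)) (upTo y)) ++ deltaCw a b (suc x) y w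

Δc : ℕ → ℕ → List ℕ → List ℤ
Δc a b π = deltaCw a b 0 0 (word a b π)

g : ℕ → List ℤ → ℤ → ℕ
g a Δ β = length (filter (λ j → (β ℤ.+ + j) ∈? Δ) (upTo a))

Gcols : ℕ → ℕ → List ℕ → List ℕ
Gcols a b π = map (g a (Δc a b π)) (generators a b π)

labels : ℕ → ℕ → List Step → ℤ → List (ℤ × Step)
labels a b [] l = []
labels a b (N ∷ u) l = (l ℤ.+ + b , N) ∷ labels a b u (l ℤ.+ + b)
labels a b (E ∷ u) l = (l ℤ.- + a , E) ∷ labels a b u (l ℤ.- + a)

-- the order of levels: 0, -1, -2, …, -M, then M, M-1, …, 1,
-- where M = (a+b)·|u| bounds every |lᵢ|
levelOrder : ℕ → List ℤ
levelOrder M = map (λ i → - (+ i)) (upTo (suc M)) ++ map (λ i → + suc i) (reverse (upTo M))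

sw⁺ : ℕ → ℕ → List Step → List Step
sw⁺ a b u = concatMap (λ k → map proj₂ (filter (λ p → proj₁ p ℤ.≟ k) (labels a b u (+ 0))))
                      (levelOrder ((a ℕ.+ b) ℕ.* length u))

module Submission where

-- Let w = word(π), a lattice path from (0,0) to (b,a), and give each step the
-- level of its starting point.  These levels are ≥ 0 (π ∈ D) and pairwise
-- distinct (by coprimality, two points of the box with equal levels are the
-- two corners).  Both sides of the identity turn out to be "the steps of w
-- listed by increasing level":
--  * sw⁺: the labels of rev(w) are the negated levels, so reading the labels
--    0, -1, -2, … bucket-sorts the steps by level; positive labels never occur.
--  * G(π): the b-generators are the levels of the east steps minus a, and
--    g(β) is the number of north steps of level ≥ β + a.  Indeed a positive
--    level t lies in Δᶜ iff it lies below the level k of exactly one north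
--    step, in the residue class of k modulo a (again by coprimality), and a
--    window of a consecutive integers meets that class below k once or never,
--    according as it lies below k or not.  Finally, the column word whose
--    columns count, in increasing order of the east steps, the north steps
--    above them is the sorted list of steps itself.

open import Defs
open import Data.Empty using (⊥; ⊥-elim)
open import Data.Integer as ℤ using (ℤ; +_; -_)
import Data.Integer.Properties as ℤP
open import Data.Integer.Tactic.RingSolver using (solve-∀)
open import Data.List
  using (List; []; _∷_; _++_; [_]; map; filter; concatMap; upTo; reverse; reverseAcc; replicate; length; mapMaybe)
import Data.List.Properties as LP
open import Data.List.Membership.Propositional using (_∈_; lose)
open import Data.List.Membership.Propositional.Properties
  using (∈-++⁻; ∈-++⁺ˡ; ∈-++⁺ʳ; ∈-filter⁻; ∈-filter⁺; ∈-map⁻; ∈-map⁺; ∈-upTo⁻; ∈-upTo⁺)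
open import Data.List.Membership.DecPropositional ℤ._≟_ using (_∈?_)
open import Data.List.Relation.Binary.Permutation.Propositional
  using (_↭_; ↭-sym; ↭-trans; prep; ↭-reflexive; ↭⇒↭ₛ′)
import Data.List.Relation.Binary.Permutation.Propositional.Properties as PermP
open import Data.List.Relation.Binary.Pointwise using (Pointwise-≡⇒≡)
open import Data.List.Relation.Unary.All as All using (All; []; _∷_)
import Data.List.Relation.Unary.All.Properties as AllP
open import Data.List.Relation.Unary.AllPairs using (AllPairs; []; _∷_)
import Data.List.Relation.Unary.AllPairs.Properties as AllPairsP
open import Data.List.Relation.Unary.Any using (Any; here; there)
open import Data.List.Relation.Unary.Linked as Linked using (Linked; _∷_)
import Data.List.Relation.Unary.Linked.Properties as LinkedP
import Data.List.Relation.Unary.Sorted.TotalOrder.Properties as SortedP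
open import Data.List.Sort.InsertionSort ℤP.≤-decTotalOrder using (sort)
import Data.List.Sort.InsertionSort.Properties ℤP.≤-decTotalOrder as SortP
open import Data.Maybe using (Maybe; just; nothing)
open import Data.Nat as ℕ
  using (ℕ; zero; suc; _+_; _*_; _∸_; _<_; _≤_; _≥_; z≤n; s≤s; NonZero; _%_; _/_)
import Data.Nat.Properties as ℕP
open import Algebra.Properties.CommutativeSemigroup ℕP.+-commutativeSemigroup using (interchange)
open import Data.Nat.Coprimality using (Coprime; coprime-divisor; gcd≡1⇒coprime)
open import Data.Nat.Divisibility
  using (_∣_; _∣?_; divides; quotient; m∣n⇒n≡quotient*m; ∣⇒≤; ∣m+n∣m⇒∣n; ∣m∣n⇒∣m+n; m∣m*n)
open import Data.Nat.DivMod using (m≡m%n+[m/n]*n; m%n<n)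
open import Data.Nat.GCD using (gcd)
open import Data.Nat.ListAction using (sum)
import Data.Nat.ListAction.Properties as SumP
import Data.Nat.Tactic.RingSolver as ℕ-Solver
open import Data.Product using (∃-syntax; _×_; _,_; proj₁; proj₂)
open import Data.Sum using (_⊎_; inj₁; inj₂)
open import Function using (_∘_)
open import Relation.Binary.PropositionalEquality
  using (_≡_; _≢_; refl; sym; trans; cong; cong₂; subst; isEquivalence; module ≡-Reasoning)
open import Relation.Nullary using (Dec; yes; no; ¬_; _×-dec_)
open import Relation.Unary using (Decidable)

𝟙 : ∀ {P : Set} → Dec P → ℕ
𝟙 (yes _) = 1
𝟙 (no _)  = 0

𝟙-cong : ∀ {P Q : Set} (P? : Dec P) (Q? : Dec Q) → (P → Q) → (Q → P) → 𝟙 P? ≡ 𝟙 Q?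
𝟙-cong (yes _) (yes _) _ _ = refl
𝟙-cong (no _)  (no _)  _ _ = refl
𝟙-cong (yes p) (no ¬q) f _ = ⊥-elim (¬q (f p))
𝟙-cong (no ¬p) (yes q) _ g = ⊥-elim (¬p (g q))

variable
  A B : Set

sum-map-++ : ∀ (f : A → ℕ) xs ys → sum (map f (xs ++ ys)) ≡ sum (map f xs) + sum (map f ys)
sum-map-++ f xs ys = trans (cong sum (LP.map-++ f xs ys)) (SumP.sum-++ (map f xs) (map f ys))

sum-map-↭ : ∀ (f : A → ℕ) {xs ys} → xs ↭ ys → sum (map f xs) ≡ sum (map f ys)
sum-map-↭ f p = SumP.sum-↭ (PermP.map⁺ f p)

sum-map-cong : ∀ {f g : A → ℕ} {xs} → All (λ x → f x ≡ g x) xs → sum (map f xs) ≡ sum (map g xs)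
sum-map-cong eqs = cong sum (LP.map-cong-local eqs)

sum-map-0 : ∀ xs → sum (map (λ (_ : A) → 0) xs) ≡ 0
sum-map-0 []       = refl
sum-map-0 (_ ∷ xs) = sum-map-0 xs

sum-map-+ : ∀ (f g : A → ℕ) xs → sum (map (λ x → f x + g x) xs) ≡ sum (map f xs) + sum (map g xs)
sum-map-+ f g []       = refl
sum-map-+ f g (x ∷ xs) = trans (cong (_+_ (f x + g x)) (sum-map-+ f g xs)) (interchange (f x) (g x) _ _)

sum-map-comm : ∀ (f : A → B → ℕ) xs ys →
  sum (map (λ x → sum (map (f x) ys)) xs) ≡ sum (map (λ y → sum (map (λ x → f x y) xs)) ys)
sum-map-comm f []       ys = sym (sum-map-0 ys)
sum-map-comm f (x ∷ xs) ys = trans (cong (_+_ (sum (map (f x) ys))) (sum-map-comm f xs ys))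
                                   (sym (sum-map-+ (f x) _ ys))

module _ {P : A → Set} (P? : Decidable P) where

  length-filter : ∀ xs → length (filter P? xs) ≡ sum (map (𝟙 ∘ P?) xs)
  length-filter []       = refl
  length-filter (x ∷ xs) with P? x
  ... | yes _ = cong suc (length-filter xs)
  ... | no  _ = length-filter xs

  count-none : ∀ {xs} → All (¬_ ∘ P) xs → sum (map (𝟙 ∘ P?) xs) ≡ 0
  count-none {[]}     []           = refl
  count-none {x ∷ xs} (¬px ∷ ¬pxs) with P? x
  ... | yes px = ⊥-elim (¬px px)
  ... | no  _  = count-none ¬pxs

  count-unique : ∀ {xs} → AllPairs (λ x y → ¬ (P x × P y)) xs → Any P xs → sum (map (𝟙 ∘ P?) xs) ≡ 1
  count-unique {x ∷ xs} (excl ∷ _) (here px) with P? x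
  ... | yes _  = cong suc (count-none (All.map (λ ex py → ex (px , py)) excl))
  ... | no ¬px = ⊥-elim (¬px px)
  count-unique {x ∷ xs} (excl ∷ excls) (there any) with P? x
  ... | yes px = ⊥-elim (All.lookupWith (λ ex py → ex (px , py)) excl any)
  ... | no  _  = count-unique excls any

filter-map : ∀ {P : B → Set} (P? : Decidable P) (f : A → B) xs →
  filter P? (map f xs) ≡ map f (filter (P? ∘ f) xs)
filter-map P? f []       = refl
filter-map P? f (x ∷ xs) with P? (f x)
... | yes _ = cong (f x ∷_) (filter-map P? f xs)
... | no  _ = filter-map P? f xs

filter-reverse : ∀ {P : A → Set} (P? : Decidable P) xs → filter P? (reverse xs) ≡ reverse (filter P? xs)
filter-reverse P? []       = refl
filter-reverse P? (x ∷ xs) = begin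
  filter P? (reverse (x ∷ xs))              ≡⟨ cong (filter P?) (LP.unfold-reverse x xs) ⟩
  filter P? (reverse xs ++ [ x ])           ≡⟨ LP.filter-++ P? (reverse xs) [ x ] ⟩
  filter P? (reverse xs) ++ filter P? [ x ] ≡⟨ cong (_++ filter P? [ x ]) (filter-reverse P? xs) ⟩
  reverse (filter P? xs) ++ filter P? [ x ] ≡⟨ snoc-filtered ⟩
  reverse (filter P? (x ∷ xs))              ∎
  where
  open ≡-Reasoning
  snoc-filtered : reverse (filter P? xs) ++ filter P? [ x ] ≡ reverse (filter P? (x ∷ xs))
  snoc-filtered with P? x
  ... | yes _ = sym (LP.unfold-reverse x (filter P? xs))
  ... | no  _ = LP.++-identityʳ _

concatMap-nil : ∀ (f : A → List B) xs → (∀ x → f x ≡ []) → concatMap f xs ≡ []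
concatMap-nil f []       _   = refl
concatMap-nil f (x ∷ xs) nil = trans (cong (_++ concatMap f xs) (nil x)) (concatMap-nil f xs nil)

concatMap-upTo-suc : ∀ (f : ℕ → List A) n → concatMap f (upTo (suc n)) ≡ concatMap f (upTo n) ++ f n
concatMap-upTo-suc f n = begin
  concatMap f (upTo (suc n))          ≡⟨ cong (concatMap f) (sym (LP.upTo-∷ʳ n)) ⟩
  concatMap f (upTo n ++ [ n ])       ≡⟨ LP.concatMap-++ f (upTo n) [ n ] ⟩
  concatMap f (upTo n) ++ (f n ++ []) ≡⟨ cong (concatMap f (upTo n) ++_) (LP.++-identityʳ (f n)) ⟩
  concatMap f (upTo n) ++ f n         ∎
  where open ≡-Reasoning

concatMap-upTo-cong : ∀ (f g : ℕ → List A) n → (∀ i → i < n → f i ≡ g i) →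
  concatMap f (upTo n) ≡ concatMap g (upTo n)
concatMap-upTo-cong f g zero    _  = refl
concatMap-upTo-cong f g (suc n) eq = begin
  concatMap f (upTo (suc n))   ≡⟨ concatMap-upTo-suc f n ⟩
  concatMap f (upTo n) ++ f n  ≡⟨ cong₂ _++_ (concatMap-upTo-cong f g n (λ i i<n → eq i (ℕP.m<n⇒m<1+n i<n)))
                                            (eq n (ℕP.n<1+n n)) ⟩
  concatMap g (upTo n) ++ g n  ≡⟨ sym (concatMap-upTo-suc g n) ⟩
  concatMap g (upTo (suc n))   ∎
  where open ≡-Reasoning

concatMap-upTo-insert : ∀ (f g : ℕ → List A) q k n → k < n → f k ≡ q ∷ g k →
  (∀ i → i ≢ k → f i ≡ g i) → concatMap f (upTo n) ↭ q ∷ concatMap g (upTo n)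
concatMap-upTo-insert f g q k (suc n) k<1+n fk fi
  rewrite concatMap-upTo-suc f n | concatMap-upTo-suc g n
  with ℕP.m≤n⇒m<n∨m≡n (ℕP.≤-pred k<1+n)
... | inj₁ k<n rewrite fi n (λ n≡k → ℕP.<-irrefl (sym n≡k) k<n) =
  PermP.++⁺ʳ (g n) (concatMap-upTo-insert f g q k n k<n fk fi)
... | inj₂ refl rewrite fk | concatMap-upTo-cong f g k (λ i i<k → fi i (λ i≡k → ℕP.<-irrefl i≡k i<k)) =
  PermP.shift q (concatMap g (upTo k)) (g k)

any-with : ∀ {P Q R : A → Set} {xs} → (∀ {x} → R x → P x → Q x) → All R xs → Any P xs → Any Q xs
any-with f (r ∷ _)  (here p)    = here (f r p)
any-with f (_ ∷ rs) (there any) = there (any-with f rs any)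

sort-unique : ∀ {xs ys} → Linked ℤ._≤_ ys → xs ↭ ys → sort xs ≡ ys
sort-unique {xs} ys↗ xs↭ys = Pointwise-≡⇒≡ (SortedP.↗↭↗⇒≋ ℤP.≤-totalOrder (SortP.sort-↗ xs) ys↗
  (↭⇒↭ₛ′ isEquivalence (↭-trans (SortP.sort-↭ xs) xs↭ys)))

module Buckets {A : Set} (key : A → ℤ) where

  bucket : List A → ℕ → List A
  bucket P i = filter (λ q → key q ℤ.≟ + i) P

  bucketSort : List A → ℕ → List A
  bucketSort P n = concatMap (bucket P) (upTo n)

  DistinctKeys : List A → Set
  DistinctKeys = AllPairs (λ q r → key q ≢ key r)

  Increasing : List A → Set
  Increasing = AllPairs (λ q r → key q ℤ.< key r)

  InRange : ℕ → A → Set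
  InRange n q = ∃[ k ] key q ≡ + k × k < n

  key-class : ∀ {P} → DistinctKeys P → ∀ k →
    filter (λ q → key q ℤ.≟ k) P ≡ [] ⊎ ∃[ q ] filter (λ q → key q ℤ.≟ k) P ≡ [ q ]
  key-class {[]}    []             k = inj₁ refl
  key-class {q ∷ P} (q≢ ∷ distinct) k with key q ℤ.≟ k
  ... | yes q≡k = inj₂ (q , cong (q ∷_) (LP.filter-none (λ r → key r ℤ.≟ k)
                               (All.map (λ q≢r r≡k → q≢r (trans q≡k (sym r≡k))) q≢)))
  ... | no  _   = key-class distinct k

  bucket-key : ∀ P i → All (λ q → key q ≡ + i) (bucket P i)
  bucket-key P i = AllP.all-filter (λ q → key q ℤ.≟ + i) P

  bucketSort-bounded : ∀ P n → All (λ q → key q ℤ.< + n) (bucketSort P n)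
  bucketSort-bounded P zero    = []
  bucketSort-bounded P (suc n) rewrite concatMap-upTo-suc (bucket P) n =
    AllP.++⁺ (All.map (λ q<n → ℤP.<-trans q<n (ℤ.+<+ (ℕP.n<1+n n))) (bucketSort-bounded P n))
             (All.map (λ q≡n → subst (ℤ._< + suc n) (sym q≡n) (ℤ.+<+ (ℕP.n<1+n n))) (bucket-key P n))

  bucketSort-increasing : ∀ {P} → DistinctKeys P → ∀ n → Increasing (bucketSort P n)
  bucketSort-increasing         d zero    = []
  bucketSort-increasing {P} d (suc n) rewrite concatMap-upTo-suc (bucket P) n =
    AllPairsP.++⁺ (bucketSort-increasing d n) bucket-increasing
      (All.map (λ {q} q<n → All.map (λ r≡n → subst (key q ℤ.<_) (sym r≡n) q<n) (bucket-key P n))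
               (bucketSort-bounded P n))
    where
    bucket-increasing : Increasing (bucket P n)
    bucket-increasing with key-class d (+ n)
    ... | inj₁ none       rewrite none = []
    ... | inj₂ (q , single) rewrite single = [] ∷ []

  bucketSort-↭ : ∀ n P → All (InRange n) P → bucketSort P n ↭ P
  bucketSort-↭ n []      []                           =
    ↭-reflexive (concatMap-nil (bucket []) (upTo n) (λ _ → refl))
  bucketSort-↭ n (q ∷ P) ((k , q≡k , k<n) ∷ inRange) =
    ↭-trans (concatMap-upTo-insert (bucket (q ∷ P)) (bucket P) q k n k<n bucket-k bucket-i)
            (prep q (bucketSort-↭ n P inRange))
    where
    bucket-k : bucket (q ∷ P) k ≡ q ∷ bucket P k
    bucket-k = LP.filter-accept (λ r → key r ℤ.≟ + k) q≡k
    bucket-i : ∀ i → i ≢ k → bucket (q ∷ P) i ≡ bucket P i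
    bucket-i i i≢k =
      LP.filter-reject (λ r → key r ℤ.≟ + i) (λ q≡i → i≢k (ℤP.+-injective (trans (sym q≡i) q≡k)))

  select : ∀ {B : Set} → List (ℤ × B) → ℤ → List B
  select L k = map proj₂ (filter (λ p → proj₁ p ℤ.≟ k) L)

  negated : ∀ {B : Set} → (A → B) → A → ℤ × B
  negated tag q = (- key q , tag q)

  module _ {B : Set} (tag : A → B) where

    -- Label -i selects bucket i (at most one element, so reversal is harmless) ...
    select-negative : ∀ {P} → DistinctKeys P → ∀ i →
      select (reverse (map (negated tag) P)) (- + i) ≡ map tag (bucket P i)
    select-negative {P} d i = begin
      map proj₂ (filter label≟ (reverse (map (negated tag) P)))
        ≡⟨ cong (map proj₂) (filter-reverse label≟ (map (negated tag) P)) ⟩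
      map proj₂ (reverse (filter label≟ (map (negated tag) P)))
        ≡⟨ cong (map proj₂ ∘ reverse) (filter-map label≟ (negated tag) P) ⟩
      map proj₂ (reverse (map (negated tag) (filter (label≟ ∘ negated tag) P)))
        ≡⟨ cong (map proj₂ ∘ reverse ∘ map (negated tag))
                (LP.filter-≐ (label≟ ∘ negated tag) (λ q → key q ℤ.≟ + i)
                             (ℤP.neg-injective , cong -_) P) ⟩
      map proj₂ (reverse (map (negated tag) (bucket P i)))
        ≡⟨ short-reverse (key-class d (+ i)) ⟩
      map tag (bucket P i) ∎
      where
      open ≡-Reasoning
      label≟ : (p : ℤ × B) → Dec (proj₁ p ≡ - + i)
      label≟ p = proj₁ p ℤ.≟ - + i
      short-reverse : ∀ {xs} → xs ≡ [] ⊎ ∃[ q ] xs ≡ [ q ] →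
        map proj₂ (reverse (map (negated tag) xs)) ≡ map tag xs
      short-reverse (inj₁ refl)       = refl
      short-reverse (inj₂ (_ , refl)) = refl

    select-positive : ∀ {P} → All (λ q → + 0 ℤ.≤ key q) P → ∀ i →
      select (reverse (map (negated tag) P)) (+ suc i) ≡ []
    select-positive {P} nonneg i = cong (map proj₂) (begin
      filter label≟ (reverse (map (negated tag) P))   ≡⟨ filter-reverse label≟ (map (negated tag) P) ⟩
      reverse (filter label≟ (map (negated tag) P))   ≡⟨ cong reverse (filter-map label≟ (negated tag) P) ⟩
      reverse (map (negated tag) (filter (label≟ ∘ negated tag) P))
        ≡⟨ cong (reverse ∘ map (negated tag)) (LP.filter-none (label≟ ∘ negated tag) (All.map ¬positive nonneg)) ⟩
      [] ∎)
      where
      open ≡-Reasoning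
      label≟ : (p : ℤ × B) → Dec (proj₁ p ≡ + suc i)
      label≟ p = proj₁ p ℤ.≟ + suc i
      ¬positive : ∀ {k} → + 0 ℤ.≤ k → - k ≢ + suc i
      ¬positive {+ zero}  _ ()
      ¬positive {+ suc _} _ ()

    select-levelOrder : ∀ {P} → DistinctKeys P → All (λ q → + 0 ℤ.≤ key q) P → ∀ M →
      concatMap (select (reverse (map (negated tag) P))) (levelOrder M) ≡ map tag (bucketSort P (suc M))
    select-levelOrder {P} d nonneg M = begin
      concatMap S (levelOrder M)
        ≡⟨ LP.concatMap-++ S (map (λ i → - + i) (upTo (suc M))) _ ⟩
      concatMap S (map (λ i → - + i) (upTo (suc M))) ++ concatMap S (map (λ i → + suc i) (reverse (upTo M)))
        ≡⟨ cong₂ _++_ (LP.concatMap-map S (λ i → - + i) (upTo (suc M)))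
                      (trans (LP.concatMap-map S (λ i → + suc i) (reverse (upTo M)))
                             (concatMap-nil _ (reverse (upTo M)) (select-positive nonneg))) ⟩
      concatMap (λ i → S (- + i)) (upTo (suc M)) ++ []
        ≡⟨ LP.++-identityʳ _ ⟩
      concatMap (λ i → S (- + i)) (upTo (suc M))
        ≡⟨ LP.concatMap-cong (select-negative d) (upTo (suc M)) ⟩
      concatMap (map tag ∘ bucket P) (upTo (suc M))
        ≡⟨ sym (LP.map-concatMap tag (bucket P) (upTo (suc M))) ⟩
      map tag (bucketSort P (suc M)) ∎
      where
      open ≡-Reasoning
      S : ℤ → List B
      S = select (reverse (map (negated tag) P))

∸-split-at : ∀ k m n → m ≤ k → n ≤ m → k ∸ n ≡ (k ∸ m) + (m ∸ n)
∸-split-at k m n m≤k n≤m = begin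
  k ∸ n               ≡⟨ cong (_∸ n) (sym (ℕP.m∸n+n≡m m≤k)) ⟩
  (k ∸ m) + m ∸ n     ≡⟨ ℕP.+-∸-assoc (k ∸ m) n≤m ⟩
  (k ∸ m) + (m ∸ n)   ∎
  where open ≡-Reasoning

module Residues (a : ℕ) .{{_ : NonZero a}} where

  multiple-below : ∀ n → a ∣ n → n < a → n ≡ 0
  multiple-below zero    _   _   = refl
  multiple-below (suc n) a∣n n<a = ⊥-elim (ℕP.<⇒≱ n<a (∣⇒≤ a∣n))

  DownFrom : ℕ → ℕ → Set
  DownFrom k t = t < k × a ∣ k ∸ t

  downFrom? : ∀ k t → Dec (DownFrom k t)
  downFrom? k t = (t ℕ.<? k) ×-dec (a ∣? (k ∸ t))

  window-exclusive : ∀ k β {i j} → i < j → j < a → ¬ (DownFrom k (β + i) × DownFrom k (β + j))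
  window-exclusive k β {i} {j} i<j j<a ((_ , a∣k-i) , (βj<k , a∣k-j)) =
    ℕP.<-irrefl (sym (multiple-below (j ∸ i) a∣gap (ℕP.≤-<-trans (ℕP.m∸n≤m j i) j<a))) (ℕP.m<n⇒0<n∸m i<j)
    where
    split : k ∸ (β + i) ≡ (k ∸ (β + j)) + (j ∸ i)
    split = trans (∸-split-at k (β + j) (β + i) (ℕP.<⇒≤ βj<k) (ℕP.+-monoʳ-≤ β (ℕP.<⇒≤ i<j)))
                  (cong (_+_ (k ∸ (β + j))) (ℕP.[m+n]∸[m+o]≡n∸o β j i))
    a∣gap : a ∣ j ∸ i
    a∣gap = ∣m+n∣m⇒∣n (subst (a ∣_) split a∣k-i) a∣k-j

  window : ∀ k β → sum (map (λ j → 𝟙 (downFrom? k (β + j))) (upTo a)) ≡ 𝟙 (β + a ℕ.≤? k)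
  window k β with β + a ℕ.≤? k
  ... | yes β+a≤k = count-unique (λ j → downFrom? k (β + j))
                      (AllPairsP.applyUpTo⁺₁ _ a (λ i<j j<a → window-exclusive k β i<j j<a))
                      (lose (∈-upTo⁺ r<a) hit)
    where
    r : ℕ
    r = (k ∸ β) % a
    r<a : r < a
    r<a = m%n<n (k ∸ β) a
    hit : DownFrom k (β + r)
    hit = βr<k , divides ((k ∸ β) / a) exact
      where
      βr<k : β + r < k
      βr<k = ℕP.<-≤-trans (ℕP.+-monoʳ-< β r<a) β+a≤k
      exact : k ∸ (β + r) ≡ ((k ∸ β) / a) * a
      exact = begin
        k ∸ (β + r)                         ≡⟨ sym (ℕP.∸-+-assoc k β r) ⟩
        (k ∸ β) ∸ r                         ≡⟨ cong (_∸ r) (m≡m%n+[m/n]*n (k ∸ β) a) ⟩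
        r + ((k ∸ β) / a) * a ∸ r           ≡⟨ ℕP.m+n∸m≡n r _ ⟩
        ((k ∸ β) / a) * a                   ∎
        where open ≡-Reasoning
  ... | no β+a≰k = count-none (λ j → downFrom? k (β + j)) (AllP.applyUpTo⁺₁ _ a miss)
    where
    miss : ∀ {j} → j < a → ¬ DownFrom k (β + j)
    miss {j} j<a (βj<k , a∣k-βj) = ℕP.<-irrefl (sym (multiple-below _ a∣k-βj small)) (ℕP.m<n⇒0<n∸m βj<k)
      where
      small : k ∸ (β + j) < a
      small = ℕP.≤-<-trans (ℕP.∸-monoʳ-≤ k (ℕP.m≤m+n β j))
                           (ℕP.m<n+o⇒m∸n<o k β (ℕP.≰⇒> β+a≰k))

module Lattice (a b : ℕ) where

  Point : Set
  Point = ℕ × ℕ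

  levelAt : Point → ℤ
  levelAt (x , y) = level a b x y

  move : Point → Step → Point
  move (x , y) N = (x , suc y)
  move (x , y) E = (suc x , y)

  δ : Step → ℤ
  δ N = + b
  δ E = - + a

  level-move : ∀ p s → levelAt (move p s) ≡ levelAt p ℤ.+ δ s
  level-move (x , y) N = begin
    + (b * suc y) ℤ.- + (a * x)       ≡⟨ cong (λ n → + n ℤ.- + (a * x)) (ℕP.*-suc b y) ⟩
    (+ b ℤ.+ + (b * y)) ℤ.- + (a * x) ≡⟨ rearrange (+ b) (+ (b * y)) (+ (a * x)) ⟩
    level a b x y ℤ.+ + b             ∎
    where
    open ≡-Reasoning
    rearrange : ∀ B Y X → (B ℤ.+ Y) ℤ.- X ≡ (Y ℤ.- X) ℤ.+ B
    rearrange = solve-∀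
  level-move (x , y) E = begin
    + (b * y) ℤ.- + (a * suc x)       ≡⟨ cong (λ n → + (b * y) ℤ.- + n) (ℕP.*-suc a x) ⟩
    + (b * y) ℤ.- (+ a ℤ.+ + (a * x)) ≡⟨ rearrange (+ (b * y)) (+ a) (+ (a * x)) ⟩
    level a b x y ℤ.+ - + a           ∎
    where
    open ≡-Reasoning
    rearrange : ∀ Y A X → Y ℤ.- (A ℤ.+ X) ≡ (Y ℤ.- X) ℤ.+ - A
    rearrange = solve-∀

  level≡+⇒ : ∀ x y k → level a b x y ≡ + k → k + a * x ≡ b * y
  level≡+⇒ x y k eq = ℤP.+-injective (begin
    + k ℤ.+ + (a * x)                       ≡⟨ cong (ℤ._+ + (a * x)) (sym eq) ⟩
    (+ (b * y) ℤ.- + (a * x)) ℤ.+ + (a * x) ≡⟨ cancel (+ (b * y)) (+ (a * x)) ⟩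
    + (b * y)                               ∎)
    where
    open ≡-Reasoning
    cancel : ∀ Y X → (Y ℤ.- X) ℤ.+ X ≡ Y
    cancel = solve-∀

  level≡+⇐ : ∀ x y k → k + a * x ≡ b * y → level a b x y ≡ + k
  level≡+⇐ x y k eq = begin
    + (b * y) ℤ.- + (a * x)                 ≡⟨ cong (λ n → + n ℤ.- + (a * x)) (sym eq) ⟩
    (+ k ℤ.+ + (a * x)) ℤ.- + (a * x)       ≡⟨ cancel (+ k) (+ (a * x)) ⟩
    + k                                     ∎
    where
    open ≡-Reasoning
    cancel : ∀ K X → (K ℤ.+ X) ℤ.- X ≡ K
    cancel = solve-∀

  PathStep : Set
  PathStep = Point × Step

  lvl : PathStep → ℤ
  lvl = levelAt ∘ proj₁

  steps : Point → List Step → List PathStep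
  steps p []      = []
  steps p (s ∷ w) = (p , s) ∷ steps (move p s) w

  endpoint : Point → List Step → Point
  endpoint p []      = p
  endpoint p (s ∷ w) = endpoint (move p s) w

  endLabel : ℤ → List Step → ℤ
  endLabel l []      = l
  endLabel l (s ∷ u) = endLabel (l ℤ.+ δ s) u

  labels-++ : ∀ u v l → labels a b (u ++ v) l ≡ labels a b u l ++ labels a b v (endLabel l u)
  labels-++ []      v l = refl
  labels-++ (N ∷ u) v l = cong (_ ∷_) (labels-++ u v _)
  labels-++ (E ∷ u) v l = cong (_ ∷_) (labels-++ u v _)

  endLabel-++ : ∀ u v l → endLabel l (u ++ v) ≡ endLabel (endLabel l u) v
  endLabel-++ []      v l = refl
  endLabel-++ (s ∷ u) v l = endLabel-++ u v _

  labels-single : ∀ l s → labels a b [ s ] l ≡ [ (l ℤ.+ δ s , s) ]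
  labels-single l N = refl
  labels-single l E = refl

  endLabel-reverse : ∀ p w l → endLabel l (reverse w) ≡ l ℤ.+ (levelAt (endpoint p w) ℤ.- levelAt p)
  endLabel-reverse p []      l = cancel l (levelAt p)
    where
    cancel : ∀ l L → l ≡ l ℤ.+ (L ℤ.- L)
    cancel = solve-∀
  endLabel-reverse p (s ∷ w) l = begin
    endLabel l (reverse (s ∷ w))                ≡⟨ cong (endLabel l) (LP.unfold-reverse s w) ⟩
    endLabel l (reverse w ++ [ s ])             ≡⟨ endLabel-++ (reverse w) [ s ] l ⟩
    endLabel l (reverse w) ℤ.+ δ s              ≡⟨ cong (ℤ._+ δ s) (endLabel-reverse (move p s) w l) ⟩
    l ℤ.+ (L ℤ.- levelAt (move p s)) ℤ.+ δ s    ≡⟨ cong (λ m → l ℤ.+ (L ℤ.- m) ℤ.+ δ s) (level-move p s) ⟩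
    l ℤ.+ (L ℤ.- (levelAt p ℤ.+ δ s)) ℤ.+ δ s   ≡⟨ cancel l L (levelAt p) (δ s) ⟩
    l ℤ.+ (L ℤ.- levelAt p)                     ∎
    where
    open ≡-Reasoning
    L : ℤ
    L = levelAt (endpoint p (s ∷ w))
    cancel : ∀ l L P d → l ℤ.+ (L ℤ.- (P ℤ.+ d)) ℤ.+ d ≡ l ℤ.+ (L ℤ.- P)
    cancel = solve-∀

  relabel : ℤ → ℤ → PathStep → ℤ × Step
  relabel l L (q , s) = (l ℤ.+ (L ℤ.- levelAt q) , s)

  labels-reverse : ∀ p w l →
    labels a b (reverse w) l ≡ reverse (map (relabel l (levelAt (endpoint p w))) (steps p w))
  labels-reverse p []      l = refl
  labels-reverse p (s ∷ w) l = begin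
    labels a b (reverse (s ∷ w)) l
      ≡⟨ cong (λ u → labels a b u l) (LP.unfold-reverse s w) ⟩
    labels a b (reverse w ++ [ s ]) l
      ≡⟨ labels-++ (reverse w) [ s ] l ⟩
    labels a b (reverse w) l ++ labels a b [ s ] (endLabel l (reverse w))
      ≡⟨ cong₂ _++_ (labels-reverse (move p s) w l) (labels-single _ s) ⟩
    reverse (map R (steps (move p s) w)) ++ [ (endLabel l (reverse w) ℤ.+ δ s , s) ]
      ≡⟨ cong (λ m → reverse (map R (steps (move p s) w)) ++ [ (m , s) ]) last-label ⟩
    reverse (map R (steps (move p s) w)) ++ [ R (p , s) ]
      ≡⟨ sym (LP.unfold-reverse (R (p , s)) (map R (steps (move p s) w))) ⟩
    reverse (map R (steps p (s ∷ w))) ∎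
    where
    open ≡-Reasoning
    R : PathStep → ℤ × Step
    R = relabel l (levelAt (endpoint p (s ∷ w)))
    last-label : endLabel l (reverse w) ℤ.+ δ s ≡ proj₁ (R (p , s))
    last-label = begin
      endLabel l (reverse w) ℤ.+ δ s ≡⟨ sym (endLabel-++ (reverse w) [ s ] l) ⟩
      endLabel l (reverse w ++ [ s ]) ≡⟨ cong (endLabel l) (sym (LP.unfold-reverse s w)) ⟩
      endLabel l (reverse (s ∷ w))    ≡⟨ endLabel-reverse p (s ∷ w) l ⟩
      proj₁ (R (p , s))               ∎

  origin : Point
  origin = (0 , 0)

  level-corner : levelAt (b , a) ≡ + 0
  level-corner = trans (cong (λ n → + (b * a) ℤ.- + n) (ℕP.*-comm a b)) (ℤP.+-inverseʳ (+ (b * a)))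

  open Buckets lvl public

  labels-reverse-closed : ∀ w → endpoint origin w ≡ (b , a) →
    labels a b (reverse w) (+ 0) ≡ reverse (map (negated proj₂) (steps origin w))
  labels-reverse-closed w closed =
    trans (labels-reverse origin w (+ 0)) (cong reverse (LP.map-cong relabel-negated (steps origin w)))
    where
    end-level : levelAt (endpoint origin w) ≡ + 0
    end-level = trans (cong levelAt closed) level-corner
    relabel-negated : ∀ q → relabel (+ 0) (levelAt (endpoint origin w)) q ≡ negated proj₂ q
    relabel-negated (q , s) = cong (_, s) (begin
      + 0 ℤ.+ (levelAt (endpoint origin w) ℤ.- levelAt q) ≡⟨ ℤP.+-identityˡ _ ⟩
      levelAt (endpoint origin w) ℤ.- levelAt q           ≡⟨ cong (ℤ._- levelAt q) end-level ⟩
      + 0 ℤ.- levelAt q                                   ≡⟨ ℤP.+-identityˡ _ ⟩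
      - levelAt q                                         ∎)
      where open ≡-Reasoning

  sw⁺-reverse : ∀ w → endpoint origin w ≡ (b , a) → DistinctKeys (steps origin w) →
    All (λ q → + 0 ℤ.≤ lvl q) (steps origin w) →
    sw⁺ a b (reverse w) ≡ map proj₂ (bucketSort (steps origin w) (suc ((a + b) * length (reverse w))))
  sw⁺-reverse w closed distinct nonneg =
    trans (cong (λ L → concatMap (select L) (levelOrder ((a + b) * length (reverse w))))
                (labels-reverse-closed w closed))
          (select-levelOrder proj₂ distinct nonneg ((a + b) * length (reverse w)))

  pathPoints-steps : ∀ {Q : Point → Set} x y w → All Q (pathPoints x y w) → All (Q ∘ proj₁) (steps (x , y) w)
  pathPoints-steps x y []      _        = []
  pathPoints-steps x y (N ∷ w) (q ∷ qs) = q ∷ pathPoints-steps x (suc y) w qs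
  pathPoints-steps x y (E ∷ w) (q ∷ qs) = q ∷ pathPoints-steps (suc x) y w qs

  pathPoints-start : ∀ {Q : Point → Set} x y w → All Q (pathPoints x y w) → Q (x , y)
  pathPoints-start x y []      (q ∷ _) = q
  pathPoints-start x y (N ∷ w) (q ∷ _) = q
  pathPoints-start x y (E ∷ w) (q ∷ _) = q

∸-peel : ∀ {h m} → h < m → m ∸ h ≡ suc (m ∸ suc h)
∸-peel {zero}  {suc m} _         = refl
∸-peel {suc h} {suc m} (s≤s h<m) = ∸-peel h<m

wordCols-N : ∀ a h cs → h < a → All (λ c → h < a ∸ c) cs → wordCols a h cs ≡ N ∷ wordCols a (suc h) cs
wordCols-N a h []       h<a _           = cong (λ n → replicate n N) (∸-peel h<a)
wordCols-N a h (c ∷ cs) _   (h<a∸c ∷ _) =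
  cong (λ n → replicate n N ++ E ∷ wordCols a (a ∸ c) cs) (∸-peel h<a∸c)

module ColumnWords (a b : ℕ) where
  open Lattice a b

  isNorth : PathStep → ℕ
  isNorth (_ , N) = 1
  isNorth (_ , E) = 0

  northAbove : ℤ → PathStep → ℕ
  northAbove s (q , N) = 𝟙 (s ℤ.≤? levelAt q)
  northAbove s (q , E) = 0

  eastLevel : PathStep → Maybe ℤ
  eastLevel (q , N) = nothing
  eastLevel (q , E) = just (levelAt q)

  eastLevels : List PathStep → List ℤ
  eastLevels = mapMaybe eastLevel

  eastLevels-All : ∀ {P : ℤ → Set} L → All (P ∘ lvl) L → All P (eastLevels L)
  eastLevels-All []            []       = []
  eastLevels-All ((_ , N) ∷ L) (_ ∷ ps) = eastLevels-All L ps
  eastLevels-All ((_ , E) ∷ L) (p ∷ ps) = p ∷ eastLevels-All L ps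

  northAbove≤isNorth : ∀ s q → northAbove s q ≤ isNorth q
  northAbove≤isNorth s (q , E) = z≤n
  northAbove≤isNorth s (q , N) with s ℤ.≤? levelAt q
  ... | yes _ = ℕP.≤-refl
  ... | no  _ = z≤n

  northAbove-count≤ : ∀ s L → sum (map (northAbove s) L) ≤ sum (map isNorth L)
  northAbove-count≤ s []      = z≤n
  northAbove-count≤ s (q ∷ L) = ℕP.+-mono-≤ (northAbove≤isNorth s q) (northAbove-count≤ s L)

  northAbove-all : ∀ s L → All (λ r → s ℤ.< lvl r) L → sum (map (northAbove s) L) ≡ sum (map isNorth L)
  northAbove-all s []            []          = refl
  northAbove-all s ((_ , E) ∷ L) (_ ∷ above) = northAbove-all s L above
  northAbove-all s ((q , N) ∷ L) (s<q ∷ above) with s ℤ.≤? levelAt q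
  ... | yes _   = cong suc (northAbove-all s L above)
  ... | no  s≰q = ⊥-elim (s≰q (ℤP.<⇒≤ s<q))

  northAbove-below : ∀ s q → levelAt q ℤ.< s → northAbove s (q , N) ≡ 0
  northAbove-below s q q<s with s ℤ.≤? levelAt q
  ... | yes s≤q = ⊥-elim (ℤP.<⇒≱ q<s s≤q)
  ... | no  _   = refl

  columnWord : ∀ h L → Increasing L → h + sum (map isNorth L) ≡ a →
    wordCols a h (map (λ s → sum (map (northAbove s) L)) (eastLevels L)) ≡ map proj₂ L
  columnWord h [] [] h+0≡a =
    cong (λ n → replicate n N) (ℕP.m≤n⇒m∸n≡0 (ℕP.≤-reflexive (trans (sym h+0≡a) (ℕP.+-identityʳ h))))
  columnWord h ((q , E) ∷ L) (q<L ∷ inc) h+n≡a = begin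
    replicate ((a ∸ C (levelAt q)) ∸ h) N ++ E ∷ wordCols a (a ∸ C (levelAt q)) cs
      ≡⟨ cong (λ m → replicate (m ∸ h) N ++ E ∷ wordCols a m cs) height ⟩
    replicate (h ∸ h) N ++ E ∷ wordCols a h cs
      ≡⟨ cong (λ k → replicate k N ++ E ∷ wordCols a h cs) (ℕP.n∸n≡0 h) ⟩
    E ∷ wordCols a h cs
      ≡⟨ cong (E ∷_) (columnWord h L inc h+n≡a) ⟩
    E ∷ map proj₂ L ∎
    where
    open ≡-Reasoning
    C : ℤ → ℕ
    C s = sum (map (northAbove s) L)
    cs : List ℕ
    cs = map C (eastLevels L)
    -- all north steps of L lie above the column, so it starts at height h
    height : a ∸ C (levelAt q) ≡ h
    height = begin
      a ∸ C (levelAt q)                             ≡⟨ cong (a ∸_) (northAbove-all (levelAt q) L q<L) ⟩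
      a ∸ sum (map isNorth L)                       ≡⟨ cong (_∸ sum (map isNorth L)) (sym h+n≡a) ⟩
      h + sum (map isNorth L) ∸ sum (map isNorth L) ≡⟨ ℕP.m+n∸n≡m h (sum (map isNorth L)) ⟩
      h                                             ∎
  columnWord h ((q , N) ∷ L) (q<L ∷ inc) h+1+n≡a = begin
    wordCols a h (map (λ s → northAbove s (q , N) + C s) (eastLevels L))
      ≡⟨ cong (wordCols a h) (LP.map-cong-local (All.map (λ q<s → cong (_+ C _) (northAbove-below _ q q<s))
                                                           (eastLevels-All L q<L))) ⟩
    wordCols a h (map C (eastLevels L))
      ≡⟨ wordCols-N a h (map C (eastLevels L)) h<a (AllP.map⁺ (All.universal below-top (eastLevels L))) ⟩
    N ∷ wordCols a (suc h) (map C (eastLevels L))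
      ≡⟨ cong (N ∷_) (columnWord (suc h) L inc top) ⟩
    N ∷ map proj₂ L ∎
    where
    open ≡-Reasoning
    C : ℤ → ℕ
    C s = sum (map (northAbove s) L)
    top : suc h + sum (map isNorth L) ≡ a
    top = trans (sym (ℕP.+-suc h _)) h+1+n≡a
    h<a : h < a
    h<a = ℕP.≤-trans (ℕP.m≤m+n (suc h) _) (ℕP.≤-reflexive top)
    below-top : ∀ s → h < a ∸ C s
    below-top s = ℕP.m+n≤o⇒m≤o∸n (suc h) (ℕP.≤-trans (ℕP.+-monoʳ-≤ (suc h) (northAbove-count≤ s L))
                                                      (ℕP.≤-reflexive top))

  genLevels-eastLevels : ∀ x y w → genLevels a b x y w ≡ map (ℤ._- + a) (eastLevels (steps (x , y) w))
  genLevels-eastLevels x y []      = refl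
  genLevels-eastLevels x y (N ∷ w) = genLevels-eastLevels x (suc y) w
  genLevels-eastLevels x y (E ∷ w) = cong₂ _∷_ (level-move (x , y) E) (genLevels-eastLevels (suc x) y w)

  -- Each such square has its south-east corner on the path.
  genLevels-All : ∀ {Q : ℤ → Set} x y w → All (λ p → Q (level a b (proj₁ p) (proj₂ p))) (pathPoints x y w) →
    All Q (genLevels a b x y w)
  genLevels-All x y []      _        = []
  genLevels-All x y (N ∷ w) (_ ∷ qs) = genLevels-All x (suc y) w qs
  genLevels-All x y (E ∷ w) (_ ∷ qs) = pathPoints-start (suc x) y w qs ∷ genLevels-All (suc x) y w qs

  eastLevels-increasing : ∀ {L} → Increasing L → AllPairs ℤ._<_ (eastLevels L)
  eastLevels-increasing {[]}          []           = []
  eastLevels-increasing {(_ , N) ∷ L} (_ ∷ inc)    = eastLevels-increasing inc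
  eastLevels-increasing {(_ , E) ∷ L} (q<L ∷ inc) = eastLevels-All L q<L ∷ eastLevels-increasing inc

module PartitionPaths (a b : ℕ) where
  open Lattice a b

  -- p ≤ r₁ ≤ r₂ ≤ … ≤ b: row lengths, read from the bottom, of a partition in the box.
  data Ascending : ℕ → List ℕ → Set where
    top  : ∀ {p} → p ≤ b → Ascending p []
    next : ∀ {p r rs} → p ≤ r → Ascending r rs → Ascending p (r ∷ rs)

  ascending-reverseAcc : ∀ x xs ys → Linked _≥_ (x ∷ xs) → Ascending x ys →
    Ascending 0 (reverseAcc ys (x ∷ xs))
  ascending-reverseAcc x []        ys _            asc = next z≤n asc
  ascending-reverseAcc x (x′ ∷ xs) ys (x≥x′ ∷ dec) asc = ascending-reverseAcc x′ xs (x ∷ ys) dec (next x≥x′ asc)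

  ascending-zeros : ∀ k ys → Ascending 0 ys → Ascending 0 (reverseAcc ys (replicate k 0))
  ascending-zeros zero    ys asc = asc
  ascending-zeros (suc k) ys asc = ascending-zeros k (0 ∷ ys) (next z≤n asc)

  rows : List ℕ → List ℕ
  rows π = reverse (π ++ replicate (a ∸ length π) 0)

  rows-ascending : ∀ π → Linked _≥_ π → All (_≤ b) π → Ascending 0 (rows π)
  rows-ascending π dec bounded =
    subst (Ascending 0) (sym (LP.foldl-++ _ [] π (replicate (a ∸ length π) 0)))
          (ascending-zeros (a ∸ length π) (reverse π) (reversed π dec bounded))
    where
    reversed : ∀ π → Linked _≥_ π → All (_≤ b) π → Ascending 0 (reverse π)
    reversed []      _   _             = top z≤n
    reversed (x ∷ π) dec (x≤b ∷ _) = ascending-reverseAcc x π [] dec (top x≤b)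

  rows-length : ∀ π → length π ≤ a → length (rows π) ≡ a
  rows-length π ℓ≤a = begin
    length (rows π)                             ≡⟨ LP.length-reverse (π ++ replicate (a ∸ length π) 0) ⟩
    length (π ++ replicate (a ∸ length π) 0)    ≡⟨ LP.length-++ π ⟩
    length π + length (replicate (a ∸ length π) 0) ≡⟨ cong (_+_ (length π)) (LP.length-replicate (a ∸ length π)) ⟩
    length π + (a ∸ length π)                   ≡⟨ ℕP.m+[n∸m]≡n ℓ≤a ⟩
    a                                           ∎
    where open ≡-Reasoning

  steps-++ : ∀ p u v → steps p (u ++ v) ≡ steps p u ++ steps (endpoint p u) v
  steps-++ p []      v = refl
  steps-++ p (s ∷ u) v = cong ((p , s) ∷_) (steps-++ (move p s) u v)

  endpoint-++ : ∀ p u v → endpoint p (u ++ v) ≡ endpoint (endpoint p u) v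
  endpoint-++ p []      v = refl
  endpoint-++ p (s ∷ u) v = endpoint-++ (move p s) u v

  endpoint-east : ∀ x y k → endpoint (x , y) (replicate k E) ≡ (x + k , y)
  endpoint-east x y zero    = cong (_, y) (sym (ℕP.+-identityʳ x))
  endpoint-east x y (suc k) = trans (endpoint-east (suc x) y k) (cong (_, y) (sym (ℕP.+-suc x k)))

  endpoint-run : ∀ {p r} y → p ≤ r → endpoint (p , y) (replicate (r ∸ p) E) ≡ (r , y)
  endpoint-run {p} y p≤r = trans (endpoint-east p y _) (cong (_, y) (ℕP.m+[n∸m]≡n p≤r))

  endpoint-rows : ∀ {p rs} y → Ascending p rs → endpoint (p , y) (wordRows b p rs) ≡ (b , y + length rs)
  endpoint-rows {p} {[]} y (top p≤b) = begin
    endpoint (p , y) (replicate (b ∸ p) E) ≡⟨ endpoint-run y p≤b ⟩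
    (b , y)                                ≡⟨ cong (b ,_) (sym (ℕP.+-identityʳ y)) ⟩
    (b , y + 0)                            ∎
    where open ≡-Reasoning
  endpoint-rows {p} {r ∷ rs} y (next p≤r asc) = begin
    endpoint (p , y) (replicate (r ∸ p) E ++ N ∷ wordRows b r rs)
      ≡⟨ endpoint-++ (p , y) (replicate (r ∸ p) E) _ ⟩
    endpoint (endpoint (p , y) (replicate (r ∸ p) E)) (N ∷ wordRows b r rs)
      ≡⟨ cong (λ q → endpoint q (N ∷ wordRows b r rs)) (endpoint-run y p≤r) ⟩
    endpoint (r , suc y) (wordRows b r rs)
      ≡⟨ endpoint-rows (suc y) asc ⟩
    (b , suc y + length rs)
      ≡⟨ cong (b ,_) (sym (ℕP.+-suc y (length rs))) ⟩
    (b , y + length (r ∷ rs)) ∎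
    where open ≡-Reasoning

  _≼_ : Point → Point → Set
  (x , y) ≼ (x′ , y′) = x ≤ x′ × y ≤ y′

  weight : Point → ℕ
  weight (x , y) = x + y

  ≼-refl : ∀ p → p ≼ p
  ≼-refl (x , y) = ℕP.≤-refl , ℕP.≤-refl

  ≼-trans : ∀ p q r → p ≼ q → q ≼ r → p ≼ r
  ≼-trans (x , y) (x′ , y′) (x″ , y″) (x≤x′ , y≤y′) (x′≤x″ , y′≤y″) =
    ℕP.≤-trans x≤x′ x′≤x″ , ℕP.≤-trans y≤y′ y′≤y″

  move-≼ : ∀ p s → p ≼ move p s
  move-≼ (x , y) N = ℕP.≤-refl , ℕP.n≤1+n y
  move-≼ (x , y) E = ℕP.n≤1+n x , ℕP.≤-refl

  weight-move : ∀ p s → weight (move p s) ≡ suc (weight p)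
  weight-move (x , y) N = ℕP.+-suc x y
  weight-move (x , y) E = refl

  endpoint-≽ : ∀ p w → p ≼ endpoint p w
  endpoint-≽ p []      = ≼-refl p
  endpoint-≽ p (s ∷ w) = ≼-trans p (move p s) _ (move-≼ p s) (endpoint-≽ (move p s) w)

  weight-endpoint : ∀ p w → weight (endpoint p w) ≡ weight p + length w
  weight-endpoint p []      = sym (ℕP.+-identityʳ (weight p))
  weight-endpoint p (s ∷ w) = begin
    weight (endpoint (move p s) w)  ≡⟨ weight-endpoint (move p s) w ⟩
    weight (move p s) + length w    ≡⟨ cong (_+ length w) (weight-move p s) ⟩
    suc (weight p) + length w       ≡⟨ sym (ℕP.+-suc (weight p) (length w)) ⟩
    weight p + length (s ∷ w)       ∎
    where open ≡-Reasoning

  Within : Point → Point → PathStep → Set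
  Within p e (q , _) = p ≼ q × q ≼ e × weight q < weight e

  steps-within : ∀ p w → All (Within p (endpoint p w)) (steps p w)
  steps-within p []      = []
  steps-within p (s ∷ w) =
    (≼-refl p , endpoint-≽ p (s ∷ w) , first-strict)
    ∷ All.map (λ { {q , _} (after , before , lighter) → ≼-trans p (move p s) q (move-≼ p s) after , before , lighter })
              (steps-within (move p s) w)
    where
    first-strict : weight p < weight (endpoint p (s ∷ w))
    first-strict = subst (weight p <_) (sym (weight-endpoint p (s ∷ w)))
                         (ℕP.m<m+n (weight p) (s≤s z≤n))

  ≼⇒weight≤ : ∀ p q → p ≼ q → weight p ≤ weight q
  ≼⇒weight≤ (x , y) (x′ , y′) (x≤x′ , y≤y′) = ℕP.+-mono-≤ x≤x′ y≤y′

  -- A point of the box of nonnegative level has a level in [0, M], where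
  -- M = (a + b)² bounds the levels tested by sw⁺ on a path of length a + b.
  steps-in-range : ∀ w → endpoint origin w ≡ (b , a) → All (λ q → + 0 ℤ.≤ lvl q) (steps origin w) →
    All (InRange (suc ((a + b) * length (reverse w)))) (steps origin w)
  steps-in-range w closed nonneg = All.map (λ {q} → in-range {q}) (All.zip (nonneg , steps-within origin w))
    where
    length-w : length (reverse w) ≡ a + b
    length-w = begin
      length (reverse w)          ≡⟨ LP.length-reverse w ⟩
      length w                    ≡⟨ sym (weight-endpoint origin w) ⟩
      weight (endpoint origin w)  ≡⟨ cong weight closed ⟩
      b + a                       ≡⟨ ℕP.+-comm b a ⟩
      a + b                       ∎
      where open ≡-Reasoning
    in-range : ∀ {q} → + 0 ℤ.≤ lvl q × Within origin (endpoint origin w) q →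
      InRange (suc ((a + b) * length (reverse w))) q
    in-range {(x , y) , _} (0≤ , _ , before , _) =
      k , sym (ℤP.0≤i⇒+∣i∣≡i 0≤) , s≤s (begin
        k                               ≤⟨ ℕP.m≤m+n k (a * x) ⟩
        k + a * x                       ≡⟨ level≡+⇒ x y k (sym (ℤP.0≤i⇒+∣i∣≡i 0≤)) ⟩
        b * y                           ≤⟨ ℕP.*-monoʳ-≤ b (proj₂ (subst ((x , y) ≼_) closed before)) ⟩
        b * a                           ≤⟨ ℕP.*-mono-≤ (ℕP.m≤n+m b a) (ℕP.m≤m+n a b) ⟩
        (a + b) * (a + b)               ≡⟨ cong (_*_ (a + b)) (sym length-w) ⟩
        (a + b) * length (reverse w)    ∎)
      where
      open ℕP.≤-Reasoning
      k : ℕ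
      k = ℤ.∣ level a b x y ∣

module Coprimality (a b : ℕ) (0<a : 0 < a) (coprime : Coprime a b) where
  open Lattice a b
  open PartitionPaths a b

  instance
    a≢0 : NonZero a
    a≢0 = ℕ.>-nonZero 0<a

  open Residues a

  coprime-small : ∀ d → a ∣ b * d → d < a → d ≡ 0
  coprime-small d a∣bd = multiple-below d (coprime-divisor coprime a∣bd)

  level-cross : ∀ x y x′ y′ → level a b x y ≡ level a b x′ y′ → b * y + a * x′ ≡ b * y′ + a * x
  level-cross x y x′ y′ same = ℤP.+-injective (begin
    + (b * y) ℤ.+ + (a * x′)                     ≡⟨ split (+ (b * y)) (+ (a * x)) (+ (a * x′)) ⟩
    level a b x y ℤ.+ + (a * x) ℤ.+ + (a * x′)   ≡⟨ cong (λ L → L ℤ.+ + (a * x) ℤ.+ + (a * x′)) same ⟩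
    level a b x′ y′ ℤ.+ + (a * x) ℤ.+ + (a * x′) ≡⟨ join (+ (b * y′)) (+ (a * x)) (+ (a * x′)) ⟩
    + (b * y′) ℤ.+ + (a * x)                     ∎)
    where
    open ≡-Reasoning
    split : ∀ Y X X′ → Y ℤ.+ X′ ≡ (Y ℤ.- X) ℤ.+ X ℤ.+ X′
    split = solve-∀
    join : ∀ Y′ X X′ → (Y′ ℤ.- X′) ℤ.+ X ℤ.+ X′ ≡ Y′ ℤ.+ X
    join = solve-∀

  coprime-solutions : ∀ d e → a * e ≡ b * d → d ≤ a → (d ≡ 0 × e ≡ 0) ⊎ (d ≡ a × e ≡ b)
  coprime-solutions d e ae≡bd d≤a with ℕP.m≤n⇒m<n∨m≡n d≤a
  ... | inj₁ d<a = inj₁ (d≡0 , ℕP.m*n≡0⇒m≡0 e a ea≡0)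
    where
    d≡0 : d ≡ 0
    d≡0 = coprime-small d (divides e (trans (sym ae≡bd) (ℕP.*-comm a e))) d<a
    ea≡0 : e * a ≡ 0
    ea≡0 = trans (ℕP.*-comm e a) (trans ae≡bd (trans (cong (b *_) d≡0) (ℕP.*-zeroʳ b)))
  ... | inj₂ d≡a = inj₂ (d≡a , ℕP.*-cancelˡ-≡ e b a (trans ae≡bd (trans (cong (b *_) d≡a) (ℕP.*-comm b a))))

  level-injective : ∀ p q → p ≼ q → weight p < weight q → q ≼ (b , a) → weight q < weight (b , a) →
    levelAt p ≢ levelAt q
  level-injective (x , y) (x′ , y′) (x≤x′ , y≤y′) lighter (_ , y′≤a) below-corner same =
    conclude (coprime-solutions d e ae≡bd (ℕP.≤-trans (ℕP.m∸n≤m y′ y) y′≤a))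
    where
    d e : ℕ
    d = y′ ∸ y
    e = x′ ∸ x
    x′≡ : x + e ≡ x′
    x′≡ = ℕP.m+[n∸m]≡n x≤x′
    y′≡ : y + d ≡ y′
    y′≡ = ℕP.m+[n∸m]≡n y≤y′
    ae≡bd : a * e ≡ b * d
    ae≡bd = ℕP.+-cancelˡ-≡ (b * y + a * x) _ _ (begin
      b * y + a * x + a * e ≡⟨ expandˡ a b x y e ⟩
      b * y + a * (x + e)   ≡⟨ cong (λ u → b * y + a * u) x′≡ ⟩
      b * y + a * x′        ≡⟨ level-cross x y x′ y′ same ⟩
      b * y′ + a * x        ≡⟨ cong (λ u → b * u + a * x) (sym y′≡) ⟩
      b * (y + d) + a * x   ≡⟨ expandʳ a b x y d ⟩
      b * y + a * x + b * d ∎)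
      where
      open ≡-Reasoning
      expandˡ : ∀ a b x y e → b * y + a * x + a * e ≡ b * y + a * (x + e)
      expandˡ = ℕ-Solver.solve-∀
      expandʳ : ∀ a b x y d → b * (y + d) + a * x ≡ b * y + a * x + b * d
      expandʳ = ℕ-Solver.solve-∀
    conclude : (d ≡ 0 × e ≡ 0) ⊎ (d ≡ a × e ≡ b) → ⊥
    conclude (inj₁ (d≡0 , e≡0)) = ℕP.<-irrefl (sym same-weight) lighter
      where
      same-weight : x′ + y′ ≡ x + y
      same-weight = cong₂ _+_ (trans (sym x′≡) (trans (cong (_+_ x) e≡0) (ℕP.+-identityʳ x)))
                              (trans (sym y′≡) (trans (cong (_+_ y) d≡0) (ℕP.+-identityʳ y)))
    conclude (inj₂ (d≡a , e≡b)) = ℕP.<⇒≱ below-corner (begin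
      b + a   ≡⟨ cong₂ _+_ (sym e≡b) (sym d≡a) ⟩
      e + d   ≤⟨ ℕP.+-mono-≤ (ℕP.m∸n≤m x′ x) (ℕP.m∸n≤m y′ y) ⟩
      x′ + y′ ∎)
      where open ℕP.≤-Reasoning

  steps-distinct : ∀ p w → endpoint p w ≡ (b , a) → DistinctKeys (steps p w)
  steps-distinct p []      _      = []
  steps-distinct p (s ∷ w) closed =
    All.map (λ {r} → head-distinct r) (steps-within (move p s) w) ∷ steps-distinct (move p s) w closed
    where
    head-distinct : ∀ r → Within (move p s) (endpoint (move p s) w) r → levelAt p ≢ lvl r
    head-distinct (q , _) (after , before , lighter) =
      level-injective p q (≼-trans p (move p s) q (move-≼ p s) after)
        (ℕP.<-≤-trans (subst (weight p <_) (sym (weight-move p s)) (ℕP.n<1+n (weight p)))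
                      (≼⇒weight≤ (move p s) q after))
        (subst (q ≼_) closed before)
        (subst (λ e → weight q < weight e) closed lighter)

-- The region Δᶜ between the path of a partition and the diagonal, described
-- row by row: a square lies in it iff it lies east of the north step of its row.
module Complement (a b : ℕ) where
  open Lattice a b
  open PartitionPaths a b

  squaresBelow : Point → List Step → List ℤ
  squaresBelow (x , y) w = deltaCw a b x y w

  squaresBelow-++ : ∀ p u v → squaresBelow p (u ++ v) ≡ squaresBelow p u ++ squaresBelow (endpoint p u) v
  squaresBelow-++ p       []      v = refl
  squaresBelow-++ (x , y) (N ∷ u) v = squaresBelow-++ (x , suc y) u v
  squaresBelow-++ (x , y) (E ∷ u) v =
    trans (cong (column ++_) (squaresBelow-++ (suc x , y) u v))
          (sym (LP.++-assoc column (squaresBelow (suc x , y) u) (squaresBelow (endpoint (suc x , y) u) v)))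
    where
    column : List ℤ
    column = filter (+ 0 ℤ.<?_) (map (level a b (suc x)) (upTo y))

  -- Squares of the rectangle [x₀, x₁] × [0, y]: south-east corner (c + 1, y′) with x₀ ≤ c < x₁, y′ < y.
  InRect : ℕ → ℕ → ℕ → ℤ → Set
  InRect x₀ x₁ y t = ∃[ c ] x₀ ≤ c × c < x₁ × ∃[ y′ ] y′ < y × t ≡ level a b (suc c) y′

  InRowFrom : ℤ → Point → Set
  InRowFrom t (r , y) = ∃[ c ] r ≤ c × c < b × t ≡ level a b (suc c) y

  eastRun⇒ : ∀ x y k t → t ∈ deltaCw a b x y (replicate k E) → + 0 ℤ.< t × InRect x (x + k) y t
  eastRun⇒ x y (suc k) t t∈ with ∈-++⁻ (filter (+ 0 ℤ.<?_) (map (level a b (suc x)) (upTo y))) t∈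
  ... | inj₁ t∈col with ∈-filter⁻ (+ 0 ℤ.<?_) t∈col
  ...   | t∈levels , 0<t with ∈-map⁻ (level a b (suc x)) t∈levels
  ...     | y′ , y′∈ , t≡ = 0<t , x , ℕP.≤-refl , ℕP.m<m+n x (s≤s z≤n) , y′ , ∈-upTo⁻ y′∈ , t≡
  eastRun⇒ x y (suc k) t t∈ | inj₂ t∈rest with eastRun⇒ (suc x) y k t t∈rest
  ... | 0<t , c , x<c , c<x+1+k , rest = 0<t , c , ℕP.<⇒≤ x<c , subst (c <_) (sym (ℕP.+-suc x k)) c<x+1+k , rest

  eastRun⇐ : ∀ x y k t → + 0 ℤ.< t → InRect x (x + k) y t → t ∈ deltaCw a b x y (replicate k E)
  eastRun⇐ x y zero    t _   (c , x≤c , c<x+0 , _) = ⊥-elim (ℕP.<⇒≱ (subst (c <_) (ℕP.+-identityʳ x) c<x+0) x≤c)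
  eastRun⇐ x y (suc k) t 0<t (c , x≤c , c<x+1+k , y′ , y′<y , t≡) with ℕP.m≤n⇒m<n∨m≡n x≤c
  ... | inj₂ refl =
    ∈-++⁺ˡ (∈-filter⁺ (+ 0 ℤ.<?_) (subst (_∈ map (level a b (suc x)) (upTo y)) (sym t≡)
                                         (∈-map⁺ (level a b (suc x)) (∈-upTo⁺ y′<y))) 0<t)
  ... | inj₁ x<c =
    ∈-++⁺ʳ (filter (+ 0 ℤ.<?_) (map (level a b (suc x)) (upTo y)))
           (eastRun⇐ (suc x) y k t 0<t (c , x<c , subst (c <_) (ℕP.+-suc x k) c<x+1+k , y′ , y′<y , t≡))

  northPoints : ℕ → List ℕ → List Point
  northPoints y []       = []
  northPoints y (r ∷ rs) = (r , y) ∷ northPoints (suc y) rs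

  ascending-bound : ∀ {p rs} → Ascending p rs → p ≤ b
  ascending-bound (top p≤b)      = p≤b
  ascending-bound (next p≤r asc) = ℕP.≤-trans p≤r (ascending-bound asc)

  squaresBelow-row : ∀ {p r} y rs → p ≤ r →
    deltaCw a b p y (wordRows b p (r ∷ rs))
      ≡ deltaCw a b p y (replicate (r ∸ p) E) ++ deltaCw a b r (suc y) (wordRows b r rs)
  squaresBelow-row {p} {r} y rs p≤r =
    trans (squaresBelow-++ (p , y) (replicate (r ∸ p) E) (N ∷ wordRows b r rs))
          (cong (λ q → deltaCw a b p y (replicate (r ∸ p) E) ++ squaresBelow q (N ∷ wordRows b r rs))
                (endpoint-run y p≤r))

  Below : ℕ → ℕ → List ℕ → ℤ → Set
  Below p y rs t = InRect p b y t ⊎ Any (InRowFrom t) (northPoints y rs)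

  eastRun-to⇒ : ∀ {p r} y t → p ≤ r → t ∈ deltaCw a b p y (replicate (r ∸ p) E) → + 0 ℤ.< t × InRect p r y t
  eastRun-to⇒ {p} y t p≤r t∈ with eastRun⇒ p y _ t t∈
  ... | 0<t , c , p≤c , c< , rest = 0<t , c , p≤c , subst (c <_) (ℕP.m+[n∸m]≡n p≤r) c< , rest

  eastRun-to⇐ : ∀ {p r} y t → p ≤ r → + 0 ℤ.< t → InRect p r y t → t ∈ deltaCw a b p y (replicate (r ∸ p) E)
  eastRun-to⇐ {p} y t p≤r 0<t (c , p≤c , c<r , rest) =
    eastRun⇐ p y _ t 0<t (c , p≤c , subst (c <_) (sym (ℕP.m+[n∸m]≡n p≤r)) c<r , rest)

  squaresBelow⇒ : ∀ {p rs} y t → Ascending p rs →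
    t ∈ deltaCw a b p y (wordRows b p rs) → + 0 ℤ.< t × Below p y rs t
  squaresBelow⇒ y t (top p≤b) t∈ with eastRun-to⇒ y t p≤b t∈
  ... | 0<t , inRect = 0<t , inj₁ inRect
  squaresBelow⇒ {p} {r ∷ rs} y t (next p≤r asc) t∈
    with ∈-++⁻ (deltaCw a b p y (replicate (r ∸ p) E)) (subst (t ∈_) (squaresBelow-row y rs p≤r) t∈)
  ... | inj₁ t∈run with eastRun-to⇒ y t p≤r t∈run
  ...   | 0<t , c , p≤c , c<r , rest = 0<t , inj₁ (c , p≤c , ℕP.<-≤-trans c<r (ascending-bound asc) , rest)
  squaresBelow⇒ {p} {r ∷ rs} y t (next p≤r asc) t∈ | inj₂ t∈rest with squaresBelow⇒ (suc y) t asc t∈rest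
  ... | 0<t , inj₂ east = 0<t , inj₂ (there east)
  ... | 0<t , inj₁ (c , r≤c , c<b , y′ , y′<1+y , t≡) with ℕP.m≤n⇒m<n∨m≡n (ℕP.≤-pred y′<1+y)
  ...   | inj₁ y′<y = 0<t , inj₁ (c , ℕP.≤-trans p≤r r≤c , c<b , y′ , y′<y , t≡)
  ...   | inj₂ refl = 0<t , inj₂ (here (c , r≤c , c<b , t≡))

  squaresBelow⇐ : ∀ {p rs} y t → Ascending p rs →
    + 0 ℤ.< t → Below p y rs t → t ∈ deltaCw a b p y (wordRows b p rs)
  squaresBelow⇐ y t (top p≤b) 0<t (inj₁ inRect) = eastRun-to⇐ y t p≤b 0<t inRect
  squaresBelow⇐ {p} {r ∷ rs} y t (next p≤r asc) 0<t below =
    subst (t ∈_) (sym (squaresBelow-row y rs p≤r)) (split below)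
    where
    run : List ℤ
    run = deltaCw a b p y (replicate (r ∸ p) E)
    later : Below r (suc y) rs t → t ∈ run ++ deltaCw a b r (suc y) (wordRows b r rs)
    later below′ = ∈-++⁺ʳ run (squaresBelow⇐ (suc y) t asc 0<t below′)
    split : Below p y (r ∷ rs) t → t ∈ run ++ deltaCw a b r (suc y) (wordRows b r rs)
    split (inj₁ (c , p≤c , c<b , y′ , y′<y , t≡)) with c ℕ.<? r
    ... | yes c<r = ∈-++⁺ˡ (eastRun-to⇐ y t p≤r 0<t (c , p≤c , c<r , y′ , y′<y , t≡))
    ... | no  c≮r = later (inj₁ (c , ℕP.≮⇒≥ c≮r , c<b , y′ , ℕP.m<n⇒m<1+n y′<y , t≡))
    split (inj₂ (here (c , r≤c , c<b , t≡))) = later (inj₁ (c , r≤c , c<b , y , ℕP.n<1+n y , t≡))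
    split (inj₂ (there east))                = later (inj₂ east)

  steps-row : ∀ {p r} y rs → p ≤ r →
    steps (p , y) (wordRows b p (r ∷ rs))
      ≡ steps (p , y) (replicate (r ∸ p) E) ++ ((r , y) , N) ∷ steps (r , suc y) (wordRows b r rs)
  steps-row {p} {r} y rs p≤r =
    trans (steps-++ (p , y) (replicate (r ∸ p) E) (N ∷ wordRows b r rs))
          (cong (λ q → steps (p , y) (replicate (r ∸ p) E) ++ steps q (N ∷ wordRows b r rs)) (endpoint-run y p≤r))

  steps-east-sum : ∀ (f : PathStep → ℕ) → (∀ q → f (q , E) ≡ 0) → ∀ x y k →
    sum (map f (steps (x , y) (replicate k E))) ≡ 0
  steps-east-sum f f-east x y zero    = refl
  steps-east-sum f f-east x y (suc k) =
    trans (cong (_+ sum (map f (steps (suc x , y) (replicate k E)))) (f-east (x , y))) (steps-east-sum f f-east (suc x) y k)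

  steps-rows-sum : ∀ (f : PathStep → ℕ) → (∀ q → f (q , E) ≡ 0) → ∀ {p rs} y → Ascending p rs →
    sum (map f (steps (p , y) (wordRows b p rs))) ≡ sum (map (λ u → f (u , N)) (northPoints y rs))
  steps-rows-sum f f-east {p} y (top _) = steps-east-sum f f-east p y (b ∸ p)
  steps-rows-sum f f-east {p} {r ∷ rs} y (next p≤r asc) = begin
    sum (map f (steps (p , y) (wordRows b p (r ∷ rs))))
      ≡⟨ cong (sum ∘ map f) (steps-row y rs p≤r) ⟩
    sum (map f (steps (p , y) (replicate (r ∸ p) E) ++ ((r , y) , N) ∷ steps (r , suc y) (wordRows b r rs)))
      ≡⟨ sum-map-++ f (steps (p , y) (replicate (r ∸ p) E)) _ ⟩
    sum (map f (steps (p , y) (replicate (r ∸ p) E))) + (f ((r , y) , N) + sum (map f (steps (r , suc y) (wordRows b r rs))))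
      ≡⟨ cong₂ _+_ (steps-east-sum f f-east p y (r ∸ p))
                   (cong (_+_ (f ((r , y) , N))) (steps-rows-sum f f-east (suc y) asc)) ⟩
    sum (map (λ u → f (u , N)) (northPoints y (r ∷ rs))) ∎
    where open ≡-Reasoning

  northPoints-All : ∀ {Q : Point → Set} {p rs} y → Ascending p rs →
    All (Q ∘ proj₁) (steps (p , y) (wordRows b p rs)) → All Q (northPoints y rs)
  northPoints-All y (top _) _ = []
  northPoints-All {Q} {p} {r ∷ rs} y (next p≤r asc) all-steps
    with AllP.++⁻ʳ (steps (p , y) (replicate (r ∸ p) E)) (subst (All (Q ∘ proj₁)) (steps-row y rs p≤r) all-steps)
  ... | q ∷ rest = q ∷ northPoints-All (suc y) asc rest

  northPoints-heights : ∀ y rs → All (λ u → y ≤ proj₂ u × proj₂ u < y + length rs) (northPoints y rs)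
  northPoints-heights y []       = []
  northPoints-heights y (r ∷ rs) =
    (ℕP.≤-refl , ℕP.m<m+n y (s≤s z≤n))
    ∷ All.map (λ { {u} (y<v , v<) → ℕP.<⇒≤ y<v , subst (proj₂ u <_) (sym (ℕP.+-suc y (length rs))) v< })
              (northPoints-heights (suc y) rs)

  northPoints-increasing : ∀ y rs → AllPairs (λ u v → proj₂ u < proj₂ v) (northPoints y rs)
  northPoints-increasing y []       = []
  northPoints-increasing y (r ∷ rs) =
    All.map proj₁ (northPoints-heights (suc y) rs) ∷ northPoints-increasing (suc y) rs

  northPoints-count : ∀ y rs → sum (map (λ _ → 1) (northPoints y rs)) ≡ length rs
  northPoints-count y []       = refl
  northPoints-count y (r ∷ rs) = cong suc (northPoints-count (suc y) rs)

module RowResidues (a b : ℕ) (0<a : 0 < a) (coprime : Coprime a b) where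
  open Lattice a b
  open Complement a b
  open Coprimality a b 0<a coprime
  open Residues a

  downFrom-form : ∀ {k t} → (t<k : t < k) (a∣k-t : a ∣ k ∸ t) → k ≡ t + quotient a∣k-t * a
  downFrom-form {k} {t} t<k a∣k-t =
    trans (sym (ℕP.m+[n∸m]≡n (ℕP.<⇒≤ t<k))) (cong (_+_ t) (m∣n⇒n≡quotient*m a∣k-t))

  row⇒down : ∀ r y k t → k + a * r ≡ b * y → InRowFrom (+ t) (r , y) → DownFrom k t
  row⇒down r y k t north (c , r≤c , _ , t≡) =
    subst (t <_) (sym k≡) (ℕP.m<m+n t (ℕP.<-≤-trans 0<a (ℕP.m≤m*n a (suc m)))) ,
    divides (suc m) (trans (cong (_∸ t) k≡) (trans (ℕP.m+n∸m≡n t (a * suc m)) (ℕP.*-comm a (suc m))))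
    where
    m : ℕ
    m = c ∸ r
    k≡ : k ≡ t + a * suc m
    k≡ = ℕP.+-cancelʳ-≡ (a * r) k (t + a * suc m) (begin
      k + a * r             ≡⟨ north ⟩
      b * y                 ≡⟨ sym (level≡+⇒ (suc c) y t (sym t≡)) ⟩
      t + a * suc c         ≡⟨ cong (λ u → t + a * suc u) (sym (ℕP.m+[n∸m]≡n r≤c)) ⟩
      t + a * suc (r + m)   ≡⟨ regroup t a r m ⟩
      t + a * suc m + a * r ∎)
      where
      open ≡-Reasoning
      regroup : ∀ t a r m → t + a * suc (r + m) ≡ t + a * suc m + a * r
      regroup = ℕ-Solver.solve-∀

  down⇒row : ∀ r y k t → k + a * r ≡ b * y → y ≤ a → 0 < t → DownFrom k t → InRowFrom (+ t) (r , y)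
  down⇒row r y k t north y≤a 0<t (t<k , a∣k-t) with quotient a∣k-t in q≡ | downFrom-form t<k a∣k-t
  ... | zero  | k≡ = ⊥-elim (ℕP.<-irrefl (sym (trans k≡ (ℕP.+-identityʳ t))) t<k)
  ... | suc m | k≡ = r + m , ℕP.m≤m+n r m , c<b , sym (level≡+⇐ (suc (r + m)) y t square)
    where
    square : t + a * suc (r + m) ≡ b * y
    square = begin
      t + a * suc (r + m)     ≡⟨ regroup t a r m ⟩
      t + suc m * a + a * r   ≡⟨ cong (_+ a * r) (sym k≡) ⟩
      k + a * r               ≡⟨ north ⟩
      b * y                   ∎
      where
      open ≡-Reasoning
      regroup : ∀ t a r m → t + a * suc (r + m) ≡ t + suc m * a + a * r
      regroup = ℕ-Solver.solve-∀
    c<b : r + m < b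
    c<b = ℕP.<-trans (ℕP.n<1+n (r + m)) (ℕP.*-cancelˡ-< a (suc (r + m)) b (begin-strict
      a * suc (r + m)       <⟨ ℕP.m<n+m (a * suc (r + m)) 0<t ⟩
      t + a * suc (r + m)   ≡⟨ square ⟩
      b * y                 ≤⟨ ℕP.*-monoʳ-≤ b y≤a ⟩
      b * a                 ≡⟨ ℕP.*-comm b a ⟩
      a * b                 ∎))
      where open ℕP.≤-Reasoning

  down-zero : ∀ r y k → k + a * r ≡ b * y → y < a → ¬ DownFrom k 0
  down-zero r y k north y<a (0<k , a∣k) = ℕP.<-irrefl (sym k≡0) 0<k
    where
    y≡0 : y ≡ 0
    y≡0 = coprime-small y (subst (a ∣_) north (∣m∣n⇒∣m+n a∣k (m∣m*n r))) y<a
    k≡0 : k ≡ 0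
    k≡0 = ℕP.m+n≡0⇒m≡0 k (trans north (trans (cong (b *_) y≡0) (ℕP.*-zeroʳ b)))

  down-unique : ∀ {ru yu ku rv yv kv t} → ku + a * ru ≡ b * yu → kv + a * rv ≡ b * yv →
    yu < yv → yv < a → DownFrom ku t → DownFrom kv t → ⊥
  down-unique {ru} {yu} {ku} {rv} {yv} {kv} {t} north-u north-v yu<yv yv<a (t<ku , a∣u) (t<kv , a∣v) =
    ℕP.<-irrefl (trans (sym (ℕP.+-identityʳ yu)) (trans (cong (_+_ yu) (sym d≡0)) yv≡)) yu<yv
    where
    qu qv d : ℕ
    qu = quotient a∣u
    qv = quotient a∣v
    d  = yv ∸ yu
    yv≡ : yu + d ≡ yv
    yv≡ = ℕP.m+[n∸m]≡n (ℕP.<⇒≤ yu<yv)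
    balance : t + a * (qv + rv) ≡ t + (a * (qu + ru) + b * d)
    balance = begin
      t + a * (qv + rv)           ≡⟨ regroupˡ t a qv rv ⟩
      t + qv * a + a * rv         ≡⟨ cong (_+ a * rv) (sym (downFrom-form t<kv a∣v)) ⟩
      kv + a * rv                 ≡⟨ north-v ⟩
      b * yv                      ≡⟨ cong (b *_) (sym yv≡) ⟩
      b * (yu + d)                ≡⟨ ℕP.*-distribˡ-+ b yu d ⟩
      b * yu + b * d              ≡⟨ cong (_+ b * d) (sym north-u) ⟩
      ku + a * ru + b * d         ≡⟨ cong (λ k → k + a * ru + b * d) (downFrom-form t<ku a∣u) ⟩
      t + qu * a + a * ru + b * d ≡⟨ regroupʳ t a qu ru (b * d) ⟩
      t + (a * (qu + ru) + b * d) ∎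
      where
      open ≡-Reasoning
      regroupˡ : ∀ t a q r → t + a * (q + r) ≡ t + q * a + a * r
      regroupˡ = ℕ-Solver.solve-∀
      regroupʳ : ∀ t a q r z → t + q * a + a * r + z ≡ t + (a * (q + r) + z)
      regroupʳ = ℕ-Solver.solve-∀
    d≡0 : d ≡ 0
    d≡0 = coprime-small d a∣bd (ℕP.≤-<-trans (ℕP.m∸n≤m yv yu) yv<a)
      where
      a∣bd : a ∣ b * d
      a∣bd = ∣m+n∣m⇒∣n (subst (a ∣_) (ℕP.+-cancelˡ-≡ t _ _ balance) (m∣m*n (qv + rv))) (m∣m*n (qu + ru))

module PartitionCounting (a b : ℕ) (0<a : 0 < a) (coprime : Coprime a b)
                         (π : List ℕ) (π∈D : InD a b π) where
  open Lattice a b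
  open ColumnWords a b
  open PartitionPaths a b
  open Coprimality a b 0<a coprime
  open Complement a b
  open Residues a
  open RowResidues a b 0<a coprime

  w : List Step
  w = word a b π

  P : List PathStep
  P = steps origin w

  Δ : List ℤ
  Δ = Δc a b π

  ascending : Ascending 0 (rows π)
  ascending = rows-ascending π (proj₁ (proj₁ π∈D)) (All.map proj₂ (proj₁ (proj₂ (proj₁ π∈D))))

  closed : endpoint origin w ≡ (b , a)
  closed = trans (endpoint-rows 0 ascending) (cong (b ,_) (rows-length π (proj₂ (proj₂ (proj₁ π∈D)))))

  nonneg : All (λ q → + 0 ℤ.≤ lvl q) P
  nonneg = pathPoints-steps 0 0 w (proj₂ π∈D)

  us : List Point
  us = northPoints 0 (rows π)

  k : Point → ℕ
  k u = ℤ.∣ levelAt u ∣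

  NorthFacts : Point → Set
  NorthFacts (r , y) = k (r , y) + a * r ≡ b * y × levelAt (r , y) ≡ + k (r , y) × y < a

  north-facts : All NorthFacts us
  north-facts = All.map (λ {u} → facts u) (All.zip (northPoints-All 0 ascending nonneg , northPoints-heights 0 (rows π)))
    where
    facts : ∀ u → + 0 ℤ.≤ levelAt u × (0 ≤ proj₂ u × proj₂ u < length (rows π)) → NorthFacts u
    facts (r , y) (0≤ , _ , y<) =
      level≡+⇒ r y (k (r , y)) (sym (ℤP.0≤i⇒+∣i∣≡i 0≤)) , sym (ℤP.0≤i⇒+∣i∣≡i 0≤) ,
      subst (y <_) (rows-length π (proj₂ (proj₂ (proj₁ π∈D)))) y<

  exclusive : ∀ t {vs} → All NorthFacts vs → AllPairs (λ u v → proj₂ u < proj₂ v) vs →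
    AllPairs (λ u v → ¬ (DownFrom (k u) t × DownFrom (k v) t)) vs
  exclusive t []     []                             = []
  exclusive t {(_ , yu) ∷ _} ((eu , _) ∷ facts) (lower ∷ incr) =
    All.map (λ { {rv , yv} ((ev , _ , yv<a) , yu<yv) (du , dv) → down-unique eu ev yu<yv yv<a du dv })
            (All.zip (facts , lower))
    ∷ exclusive t facts incr

  Δ-count : ∀ t → 𝟙 (+ t ∈? Δ) ≡ sum (map (λ u → 𝟙 (downFrom? (k u) t)) us)
  Δ-count t with + t ∈? Δ
  ... | yes t∈Δ with squaresBelow⇒ 0 (+ t) ascending t∈Δ
  ...   | _ , inj₁ (_ , _ , _ , _ , () , _)
  ...   | _ , inj₂ east = sym (count-unique (λ u → downFrom? (k u) t)
                                (exclusive t north-facts (northPoints-increasing 0 (rows π)))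
                                (any-with (λ { {r , y} (north , _) → row⇒down r y (k (r , y)) t north }) north-facts east))
  Δ-count zero    | no _   = sym (count-none (λ u → downFrom? (k u) 0)
    (All.map (λ { {r , y} (north , _ , y<a) → down-zero r y (k (r , y)) north y<a }) north-facts))
  Δ-count (suc t) | no t∉Δ = sym (count-none (λ u → downFrom? (k u) (suc t)) (AllP.¬Any⇒All¬ us (t∉Δ ∘ in-Δ)))
    where
    in-Δ : Any (λ u → DownFrom (k u) (suc t)) us → + suc t ∈ Δ
    in-Δ down = squaresBelow⇐ 0 (+ suc t) ascending (ℤ.+<+ (s≤s z≤n)) (inj₂
      (any-with (λ { {r , y} (north , _ , y<a) → down⇒row r y (k (r , y)) (suc t) north (ℕP.<⇒≤ y<a) (s≤s z≤n) })
                north-facts down))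

  g-count : ∀ β → g a Δ (+ β) ≡ sum (map (northAbove (+ (β + a))) P)
  g-count β = begin
    g a Δ (+ β)
      ≡⟨ length-filter (λ j → (+ β ℤ.+ + j) ∈? Δ) (upTo a) ⟩
    sum (map (λ j → 𝟙 (+ (β + j) ∈? Δ)) (upTo a))
      ≡⟨ cong sum (LP.map-cong (λ j → Δ-count (β + j)) (upTo a)) ⟩
    sum (map (λ j → sum (map (λ u → 𝟙 (downFrom? (k u) (β + j))) us)) (upTo a))
      ≡⟨ sum-map-comm (λ j u → 𝟙 (downFrom? (k u) (β + j))) (upTo a) us ⟩
    sum (map (λ u → sum (map (λ j → 𝟙 (downFrom? (k u) (β + j))) (upTo a))) us)
      ≡⟨ cong sum (LP.map-cong (λ u → window (k u) β) us) ⟩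
    sum (map (λ u → 𝟙 (β + a ℕ.≤? k u)) us)
      ≡⟨ sum-map-cong (All.map (λ {u} facts → above u facts) north-facts) ⟩
    sum (map (λ u → northAbove (+ (β + a)) (u , N)) us)
      ≡⟨ sym (steps-rows-sum (northAbove (+ (β + a))) (λ _ → refl) 0 ascending) ⟩
    sum (map (northAbove (+ (β + a))) P) ∎
    where
    open ≡-Reasoning
    above : ∀ u → NorthFacts u → 𝟙 (β + a ℕ.≤? k u) ≡ northAbove (+ (β + a)) (u , N)
    above (r , y) (_ , level≡ , _) =
      𝟙-cong (β + a ℕ.≤? k (r , y)) (+ (β + a) ℤ.≤? levelAt (r , y))
             (λ le → subst (+ (β + a) ℤ.≤_) (sym level≡) (ℤ.+≤+ le))
             (λ le → ℤP.drop‿+≤+ (subst (+ (β + a) ℤ.≤_) level≡ le))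

  n : ℕ
  n = suc ((a + b) * length (reverse w))

  sorted : List PathStep
  sorted = bucketSort P n

  -- Levels are distinct and in range, so `sorted` is P sorted by level.
  sorted-↭ : sorted ↭ P
  sorted-↭ = bucketSort-↭ n P (steps-in-range w closed nonneg)

  sorted-increasing : Increasing sorted
  sorted-increasing = bucketSort-increasing (steps-distinct origin w closed) n

  sw⁺-sorted : sw⁺ a b (reverse w) ≡ map proj₂ sorted
  sw⁺-sorted = sw⁺-reverse w closed (steps-distinct origin w closed) nonneg

  north-total : sum (map isNorth sorted) ≡ a
  north-total = begin
    sum (map isNorth sorted)              ≡⟨ sum-map-↭ isNorth sorted-↭ ⟩
    sum (map isNorth P)                   ≡⟨ steps-rows-sum isNorth (λ _ → refl) 0 ascending ⟩
    sum (map (λ _ → 1) us)                ≡⟨ northPoints-count 0 (rows π) ⟩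
    length (rows π)                       ≡⟨ rows-length π (proj₂ (proj₂ (proj₁ π∈D))) ⟩
    a                                     ∎
    where open ≡-Reasoning

  generators-sorted : generators a b π ≡ map (ℤ._- + a) (eastLevels sorted)
  generators-sorted = begin
    sort (genLevels a b 0 0 w)
      ≡⟨ cong sort (genLevels-eastLevels 0 0 w) ⟩
    sort (map (ℤ._- + a) (eastLevels P))
      ≡⟨ sort-unique shifted-sorted (PermP.map⁺ (ℤ._- + a) (PermP.mapMaybe-↭ eastLevel (↭-sym sorted-↭))) ⟩
    map (ℤ._- + a) (eastLevels sorted) ∎
    where
    open ≡-Reasoning
    shifted-sorted : Linked ℤ._≤_ (map (ℤ._- + a) (eastLevels sorted))
    shifted-sorted = LinkedP.map⁺ (Linked.map (λ s<t → ℤP.+-monoˡ-≤ (- + a) (ℤP.<⇒≤ s<t))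
                                              (LinkedP.AllPairs⇒Linked (eastLevels-increasing sorted-increasing)))

  columns : map (g a Δ) (map (ℤ._- + a) (eastLevels sorted))
          ≡ map (λ s → sum (map (northAbove s) sorted)) (eastLevels sorted)
  columns = trans (sym (LP.map-∘ (eastLevels sorted))) (LP.map-cong-local (All.map (λ {s} → column s) shifted-nonneg))
    where
    shifted-nonneg : All (λ s → + 0 ℤ.≤ s ℤ.- + a) (eastLevels sorted)
    shifted-nonneg = PermP.All-resp-↭ (PermP.mapMaybe-↭ eastLevel (↭-sym sorted-↭))
      (AllP.map⁻ (subst (All (+ 0 ℤ.≤_)) (genLevels-eastLevels 0 0 w) (genLevels-All 0 0 w (proj₂ π∈D))))
    column : ∀ s → + 0 ℤ.≤ s ℤ.- + a → g a Δ (s ℤ.- + a) ≡ sum (map (northAbove s) sorted)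
    column s 0≤ = begin
      g a Δ (s ℤ.- + a)                       ≡⟨ cong (g a Δ) (sym (ℤP.0≤i⇒+∣i∣≡i 0≤)) ⟩
      g a Δ (+ β)                             ≡⟨ g-count β ⟩
      sum (map (northAbove (+ (β + a))) P)    ≡⟨ cong (λ s′ → sum (map (northAbove s′) P)) (sym s≡) ⟩
      sum (map (northAbove s) P)              ≡⟨ sym (sum-map-↭ (northAbove s) sorted-↭) ⟩
      sum (map (northAbove s) sorted)         ∎
      where
      open ≡-Reasoning
      β : ℕ
      β = ℤ.∣ s ℤ.- + a ∣
      s≡ : s ≡ + (β + a)
      s≡ = trans (shift s (+ a)) (cong (ℤ._+ + a) (sym (ℤP.0≤i⇒+∣i∣≡i 0≤)))
        where
        shift : ∀ s A → s ≡ (s ℤ.- A) ℤ.+ A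
        shift = solve-∀

theorem4p12 : (a b : ℕ) → 1 ≤ a → 1 ≤ b → gcd a b ≡ 1 →
    (π : List ℕ) → InD a b π →
    wordOfColumns a (Gcols a b π) ≡ sw⁺ a b (reverse (word a b π))
theorem4p12 a b 1≤a _ gcd≡1 π π∈D = begin
  wordCols a 0 (map (g a Δ) (generators a b π))
    ≡⟨ cong (wordCols a 0 ∘ map (g a Δ)) generators-sorted ⟩
  wordCols a 0 (map (g a Δ) (map (ℤ._- + a) (eastLevels sorted)))
    ≡⟨ cong (wordCols a 0) columns ⟩
  wordCols a 0 (map (λ s → sum (map (northAbove s) sorted)) (eastLevels sorted))
    ≡⟨ columnWord 0 sorted sorted-increasing north-total ⟩
  map proj₂ sorted
    ≡⟨ sym sw⁺-sorted ⟩
  sw⁺ a b (reverse (word a b π)) ∎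
  where
  open PartitionCounting a b 1≤a (gcd≡1⇒coprime gcd≡1) π π∈D
  open ColumnWords a b
  open ≡-Reasoning
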